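{- Let $\sigma\in S_r$ and $\lambda\vdash n$ with $n>r$. Then $\pi^\lambda(\sigma)_{i,j}=0$ for all $i,j$ with $|i-j|>r!$.
   Context: For $\lambda\vdash n$, $\mathrm{SYT}(\lambda)$ is the set of standard Young tableaux of shape $\lambda$. The content of the box in row $a$, column $b$ is $b-a$; $c_k(T)$ is the content of the box containing $k$ in $T$. $\pi^\lambda$ is Young's orthogonal representation: for $s_k=(k,k+1)$, $\pi^\lambda(s_k)_{T,S}=1/(c_{k+1}(T)-c_k(T))$ if $S=T$, $\sqrt{1-1/(c_{k+1}(T)-c_k(T))^2}$ if $S$ is $T$ with $k,k+1$ exchanged, $0$ otherwise. The basis $\mathrm{SYT}(\lambda)$ is ordered by the last letter order ($T<S$ if $n$ lies in a lower row in $T$ than in $S$; if the same row, compare the rows of $n-1$, etc.), and $\pi^\lambda(\sigma)_{i,j}$ denotes the entry indexed by the $i$-th and $j$-th tableaux in this order. Permutations of $S_r$ are viewed in $S_n$ by fixing $r+1,\dots,n$. -}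

module Defs where

open import Data.Bool using (Bool; true; false; _∧_; if_then_else_)
open import Data.Nat using (ℕ; zero; suc; _∸_; _≤ᵇ_; _≡ᵇ_; _<ᵇ_)
import Data.Nat as N
open import Data.Nat.ListAction using (sum)
open import Data.Integer as ℤ using (ℤ; +_; -[1+_]; _⊖_)
open import Data.List using (List; []; _∷_; _++_; [_]; map; concatMap; downFrom;
  length; upTo; inits; take; lookup; filterᵇ; foldr)
open import Data.Fin using (Fin; toℕ)
open import Data.Maybe using (Maybe; just; nothing)
open import Function using (id; _∘_)
open import Algebra.Bundles using (CommutativeRing)
open import Relation.Binary.PropositionalEquality using (_≡_)
open import Data.Product using (_×_)

data Decreasing : List ℕ → Set where
  []  : Decreasing []
  [-] : ∀ {a} → Decreasing (a ∷ [])
  _∷_ : ∀ {a b l} → (b Data.Nat.≤ a) → Decreasing (b ∷ l) → Decreasing (a ∷ b ∷ l)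

data AllPositive : List ℕ → Set where
  []  : AllPositive []
  _∷_ : ∀ {a l} → 0 Data.Nat.< a → AllPositive l → AllPositive (a ∷ l)

IsPartitionOf : List ℕ → ℕ → Set
IsPartitionOf λ' n = Decreasing λ' × AllPositive λ' × sum λ' ≡ n

-- Tableaux as row words: a filling of a shape with 1..n is encoded by the
-- list  w = [row(1), row(2), ..., row(n)]  where row(k) ∈ {0,1,...} is the
-- (0-based) row containing k. Standardness = every prefix is a Young
-- diagram (lattice word) and final row lengths are λ.

all : {A : Set} → (A → Bool) → List A → Bool
all p []      = true
all p (x ∷ l) = p x ∧ all p l

count : ℕ → List ℕ → ℕ
count a []      = 0
count a (x ∷ w) = (if a ≡ᵇ x then 1 else 0) N.+ count a w

latticeᵇ : ℕ → List ℕ → Bool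
latticeᵇ ℓ w = all (λ p → all (λ i → count (suc i) p ≤ᵇ count i p) (upTo ℓ)) (inits w)

shapeᵇ : List ℕ → List ℕ → Bool
shapeᵇ λ' w = all (λ x → x <ᵇ length λ') w
            ∧ all (λ i → count i w ≡ᵇ lookupℕ i λ') (upTo (length λ'))
  where
  lookupℕ : ℕ → List ℕ → ℕ
  lookupℕ _       []      = 0
  lookupℕ zero    (x ∷ _) = x
  lookupℕ (suc i) (_ ∷ l) = lookupℕ i l

isSYTᵇ : List ℕ → List ℕ → Bool
isSYTᵇ λ' w = latticeᵇ (length λ') w ∧ shapeᵇ λ' w

-- All words of length n over rows {0..ℓ-1}, listed in last letter order:
-- first by row of n, lower rows (larger index) first; ties broken by the
-- row of n-1, etc.
words : ℕ → ℕ → List (List ℕ)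
words ℓ zero    = [] ∷ []
words ℓ (suc n) = concatMap (λ a → map (λ u → u ++ [ a ]) (words ℓ n)) (downFrom ℓ)

SYT : List ℕ → ℕ → List (List ℕ)
SYT λ' n = filterᵇ (isSYTᵇ λ') (words (length λ') n)

dim : List ℕ → ℕ → ℕ
dim λ' n = length (SYT λ' n)

tab : (λ' : List ℕ) (n : ℕ) → Fin (dim λ' n) → List ℕ
tab λ' n i = lookup (SYT λ' n) i

rowOf : ℕ → List ℕ → ℕ     -- row of the letter k (1-based k)
rowOf k w = go (k ∸ 1) w
  where
  go : ℕ → List ℕ → ℕ
  go _       []      = 0
  go zero    (x ∷ _) = x
  go (suc i) (_ ∷ l) = go i l

-- content c_k(T) = column - row of the box containing k (0-based row/col;
-- the difference is the same as with 1-based indices)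
content : ℕ → List ℕ → ℤ
content k w = count (rowOf k w) (take (k ∸ 1) w) ⊖ rowOf k w

-- exchange the letters k and k+1 (i.e. positions k, k+1 of the row word)
swapAt : ℕ → List ℕ → List ℕ
swapAt (suc zero) (x ∷ y ∷ l) = y ∷ x ∷ l
swapAt (suc (suc k)) (x ∷ l)  = x ∷ swapAt (suc k) l
swapAt _ l = l

eqListᵇ : List ℕ → List ℕ → Bool
eqListᵇ []      []      = true
eqListᵇ (x ∷ u) (y ∷ v) = (x ≡ᵇ y) ∧ eqListᵇ u v
eqListᵇ _       _       = false

transp : ℕ → ℕ → ℕ
transp k x = if x ≡ᵇ k then suc k else (if x ≡ᵇ suc k then k else x)

wordPerm : List ℕ → ℕ → ℕ
wordPerm w = foldr (λ k f → transp k ∘ f) id w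

-- Young's orthogonal form, with values in a commutative ring R equipped
-- with  inv a  (standing for 1/a) and  sq a  (standing for √(1 - 1/a²)).

module Young {c ℓ} (R : CommutativeRing c ℓ) where
  open CommutativeRing R

  natR : ℕ → Carrier
  natR zero    = 0#
  natR (suc n) = 1# + natR n

  intR : ℤ → Carrier
  intR (+ n)    = natR n
  intR -[1+ n ] = - natR (suc n)

  Matrix : ℕ → Set c
  Matrix m = Fin m → Fin m → Carrier

  ∑ : ∀ {m} → (Fin m → Carrier) → Carrier
  ∑ {zero}  f = 0#
  ∑ {suc m} f = f Data.Fin.zero + ∑ (f ∘ Data.Fin.suc)

  _⊛_ : ∀ {m} → Matrix m → Matrix m → Matrix m
  (A ⊛ B) i j = ∑ (λ t → A i t * B t j)

  idM : ∀ {m} → Matrix m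
  idM i j = if toℕ i ≡ᵇ toℕ j then 1# else 0#

  module Orth (inv sq : ℤ → Carrier) (λ' : List ℕ) (n : ℕ) where
    πs : ℕ → Matrix (dim λ' n)
    πs k i j =
      let T = tab λ' n i ; S = tab λ' n j
          a = content (suc k) T ℤ.- content k T
      in if eqListᵇ S T then inv a
         else (if eqListᵇ S (swapAt k T) then sq a else 0#)

    πword : List ℕ → Matrix (dim λ' n)
    πword = foldr (λ k M → πs k ⊛ M) idM

module Submission where

open import Defs
open import Data.Nat using (ℕ; suc; _<_; _≤_; ∣_-_∣; _!)
open import Data.Product using (_×_)
open import Data.Integer using (ℤ; +_)
open import Data.List using (List)
open import Data.List.Relation.Unary.All using (All)
open import Data.Fin using (Fin; toℕ)
open import Data.Fin.Permutation using (Permutation′; _⟨$⟩ʳ_)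
open import Algebra.Bundles using (CommutativeRing)
open import Relation.Binary.PropositionalEquality using (_≡_)
open import Relation.Nullary using (¬_)

open import Data.Bool using (Bool; true; false; T; if_then_else_)
open import Data.Bool.Properties using (T-∧; T?)
open import Data.Empty using (⊥-elim)
open import Data.Unit using (tt)
open import Data.Nat using (zero; _∸_; _<ᵇ_; _≡ᵇ_; z≤n; s≤s)
open import Data.Nat.ListAction using (sum)
import Data.Nat.Properties as ℕₚ
import Data.Fin as Fin
import Data.Fin.Properties as Finₚ
open import Data.List
  using ([]; _∷_; _++_; [_]; _∷ʳ_; map; concatMap; downFrom; length; lookup; filterᵇ; drop; inits; upTo)
open import Data.List.Properties
  using (filter-++; filter-none; length-filter; length-++; length-map; ++-assoc; ++-identityʳ; ∷ʳ-injective; ≡-dec)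
open import Data.List.Reverse using (Reverse; reverseView; []; _∶_∶ʳ_)
open import Data.List.Relation.Unary.All using ([]; _∷_)
import Data.List.Relation.Unary.All as All
open import Data.List.Relation.Unary.All.Properties using (map⁺; map⁻; ++⁺; ++⁻; ∷ʳ⁻; applyUpTo⁻; filter⁺)
open import Data.Product using (Σ; _,_; proj₁; proj₂)
open import Data.Sum using (_⊎_; inj₁; inj₂)
open import Function using (_∘_; id; Equivalence)
open import Relation.Binary.Definitions using (DecidableEquality)
open import Relation.Binary.PropositionalEquality using (refl; sym; trans; cong; cong₂; subst; _≢_)
open import Relation.Nullary using (yes; no)

-- Index the tableaux of shape λ by their row words
-- (row of 1, …, row of n).  For k < r the matrix π^λ(s_k) only connects a
-- tableau T to T itself and to T with k, k+1 exchanged, so it never changes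
-- the positions of r+1, …, n: it is block diagonal for the key
-- "drop r of the row word".  Block diagonal matrices are closed under
-- products, so π^λ(σ) is block diagonal for every σ ∈ S_r.
--
-- It remains to see that tableaux with equal key are fewer than r! apart in
-- last letter order.  The list of row words of length m + r is built by
-- appending a last letter to blocks of shorter words, so words sharing their
-- last m letters form one contiguous block, whose members differ only in
-- their length-r prefix.  Such a prefix of a standard tableau is a
-- restricted word (its p-th letter, counting from 0, is at most p), and there
-- are at most r! restricted words of length r.

-- It lives in its own module because it uses the natural
-- number operations _+_ and _*_, whose names the ring operations reuse.
module LastLetterOrder where
  open import Data.Nat using (_+_; _*_)

  infix 4 _[_]=_

  data _[_]=_ {A : Set} : List A → ℕ → A → Set where
    here  : ∀ {x xs} → (x ∷ xs) [ 0 ]= x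
    there : ∀ {y xs p x} → xs [ p ]= x → (y ∷ xs) [ suc p ]= x

  lookup-position : ∀ {A : Set} (xs : List A) (i : Fin (length xs)) → xs [ toℕ i ]= lookup xs i
  lookup-position (x ∷ xs) Fin.zero    = here
  lookup-position (x ∷ xs) (Fin.suc i) = there (lookup-position xs i)

  position-< : ∀ {A : Set} {xs : List A} {p x} → xs [ p ]= x → p < length xs
  position-< here      = s≤s z≤n
  position-< (there q) = s≤s (position-< q)

  position-All : ∀ {A : Set} {P : A → Set} {xs p x} → All P xs → xs [ p ]= x → P x
  position-All (px ∷ _)  here      = px
  position-All (_ ∷ pxs) (there q) = position-All pxs q

  position-++ˡ : ∀ {A : Set} {xs ys : List A} {p x} → xs [ p ]= x → (xs ++ ys) [ p ]= x
  position-++ˡ here      = here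
  position-++ˡ (there q) = there (position-++ˡ q)

  position-++ : ∀ {A : Set} (xs : List A) {ys p x} → (xs ++ ys) [ p ]= x →
                xs [ p ]= x ⊎ Σ ℕ λ p′ → p ≡ length xs + p′ × ys [ p′ ]= x
  position-++ []       q         = inj₂ (_ , refl , q)
  position-++ (y ∷ xs) here      = inj₁ here
  position-++ (y ∷ xs) (there q) with position-++ xs q
  ... | inj₁ q′              = inj₁ (there q′)
  ... | inj₂ (p′ , refl , q′) = inj₂ (p′ , refl , q′)

  position-∷ʳ : ∀ {A : Set} (xs : List A) {x} → (xs ∷ʳ x) [ length xs ]= x
  position-∷ʳ []       = here
  position-∷ʳ (y ∷ xs) = there (position-∷ʳ xs)

  position-map : ∀ {A B : Set} (f : A → B) (xs : List A) {p y} → map f xs [ p ]= y →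
                 Σ A λ x → xs [ p ]= x × y ≡ f x
  position-map f (x ∷ xs) here      = x , here , refl
  position-map f (x ∷ xs) (there q) with position-map f xs q
  ... | x′ , q′ , eq = x′ , there q′ , eq

  Clustered : {A K : Set} → (A → K) → ℕ → List A → Set
  Clustered κ B xs = ∀ {p q x y} → xs [ p ]= x → xs [ q ]= y → κ x ≡ κ y → ∣ p - q ∣ < B

  short-clustered : ∀ {A K : Set} {κ : A → K} {B xs} → length xs ≤ B → Clustered κ B xs
  short-clustered len≤B {p} {q} px qy _ =
    ℕₚ.≤-<-trans (ℕₚ.∣m-n∣≤m⊔n p q)
      (ℕₚ.⊔-lub (ℕₚ.<-≤-trans (position-< px) len≤B) (ℕₚ.<-≤-trans (position-< qy) len≤B))

  map-clustered : ∀ {A A′ K K′ : Set} {P : A → Set} {κ : A → K} {κ′ : A′ → K′} {B}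
                  (f : A → A′) {xs} →
                  (∀ {x y} → P x → P y → κ′ (f x) ≡ κ′ (f y) → κ x ≡ κ y) →
                  All P xs → Clustered κ B xs → Clustered κ′ B (map f xs)
  map-clustered f {xs} reflects pxs cl px qy same
    with position-map f xs px | position-map f xs qy
  ... | x , px′ , refl | y , qy′ , refl =
    cl px′ qy′ (reflects (position-All pxs px′) (position-All pxs qy′) same)

  ++-clustered : ∀ {A K : Set} {κ : A → K} {B} xs {ys} →
                 (∀ {p q x y} → xs [ p ]= x → ys [ q ]= y → κ x ≢ κ y) →
                 Clustered κ B xs → Clustered κ B ys → Clustered κ B (xs ++ ys)
  ++-clustered {B = B} xs apart clx cly px qy same with position-++ xs px | position-++ xs qy
  ... | inj₁ px′              | inj₁ qy′              = clx px′ qy′ same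
  ... | inj₁ px′              | inj₂ (_ , _ , qy′)    = ⊥-elim (apart px′ qy′ same)
  ... | inj₂ (_ , _ , px′)    | inj₁ qy′              = ⊥-elim (apart qy′ px′ (sym same))
  ... | inj₂ (p′ , refl , px′) | inj₂ (q′ , refl , qy′) =
    subst (_< B) (sym (ℕₚ.∣m+n-m+o∣≡∣n-o∣ (length xs) p′ q′)) (cly px′ qy′ same)

  -- blocks Y ℓ lists u ∷ʳ a for u in Y a, the last letter a running over
  -- ℓ-1, …, 1, 0; by definition  words ℓ (suc n) = blocks (λ _ → words ℓ n) ℓ.
  blocks : (ℕ → List (List ℕ)) → ℕ → List (List ℕ)
  blocks Y ℓ = concatMap (λ a → map (_∷ʳ a) (Y a)) (downFrom ℓ)

  filterᵇ-map : ∀ {A B : Set} (q : B → Bool) (f : A → B) xs →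
                filterᵇ q (map f xs) ≡ map f (filterᵇ (q ∘ f) xs)
  filterᵇ-map q f []       = refl
  filterᵇ-map q f (x ∷ xs) with q (f x)
  ... | true  = cong (f x ∷_) (filterᵇ-map q f xs)
  ... | false = filterᵇ-map q f xs

  filter-blocks : ∀ (q : List ℕ → Bool) Y ℓ →
                  filterᵇ q (blocks Y ℓ) ≡ blocks (λ a → filterᵇ (q ∘ (_∷ʳ a)) (Y a)) ℓ
  filter-blocks q Y zero    = refl
  filter-blocks q Y (suc ℓ) =
    trans (filter-++ (T? ∘ q) (map (_∷ʳ ℓ) (Y ℓ)) (blocks Y ℓ))
          (cong₂ _++_ (filterᵇ-map q (_∷ʳ ℓ) (Y ℓ)) (filter-blocks q Y ℓ))

  length-blocks : ∀ Y ℓ → length (blocks Y ℓ) ≡ sum (map (length ∘ Y) (downFrom ℓ))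
  length-blocks Y zero    = refl
  length-blocks Y (suc ℓ) =
    trans (length-++ (map (_∷ʳ ℓ) (Y ℓ)))
          (cong₂ _+_ (length-map (_∷ʳ ℓ) (Y ℓ)) (length-blocks Y ℓ))

  all-blocks : ∀ {P : List ℕ → Set} Y ℓ → (∀ a → a < ℓ → All (P ∘ (_∷ʳ a)) (Y a)) →
               All P (blocks Y ℓ)
  all-blocks Y zero    _     = []
  all-blocks Y (suc ℓ) has-P =
    ++⁺ (map⁺ (has-P ℓ ℕₚ.≤-refl)) (all-blocks Y ℓ (λ a a<ℓ → has-P a (ℕₚ.m≤n⇒m≤1+n a<ℓ)))

  length-∷ʳ : ∀ (u : List ℕ) a → length (u ∷ʳ a) ≡ suc (length u)
  length-∷ʳ u a = trans (length-++ u) (ℕₚ.+-comm (length u) 1)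

  words-length : ∀ ℓ n → All (λ u → length u ≡ n) (words ℓ n)
  words-length ℓ zero    = refl ∷ []
  words-length ℓ (suc n) =
    all-blocks (λ _ → words ℓ n) ℓ
      (λ a _ → All.map (λ {u} len → trans (length-∷ʳ u a) (cong suc len)) (words-length ℓ n))

  -- Dropping r letters commutes with appending a letter to a word of length ≥ r,
  -- so the key `drop r` remembers the last letter.
  drop-∷ʳ : ∀ r (u : List ℕ) a → r ≤ length u → drop r (u ∷ʳ a) ≡ drop r u ∷ʳ a
  drop-∷ʳ zero    u       a _         = refl
  drop-∷ʳ (suc r) (x ∷ u) a (s≤s r≤u) = drop-∷ʳ r u a r≤u

  drop-∷ʳ-injective : ∀ {r u v a b} → r ≤ length u → r ≤ length v →
                      drop r (u ∷ʳ a) ≡ drop r (v ∷ʳ b) → drop r u ≡ drop r v × a ≡ b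
  drop-∷ʳ-injective {r} {u} {v} {a} {b} r≤u r≤v same =
    ∷ʳ-injective (drop r u) (drop r v)
      (trans (sym (drop-∷ʳ r u a r≤u)) (trans same (drop-∷ʳ r v b r≤v)))

  EndsBelow : ℕ → ℕ → List ℕ → Set
  EndsBelow r ℓ x = Σ ℕ λ a → a < ℓ × Σ (List ℕ) λ v → r ≤ length v × x ≡ v ∷ʳ a

  -- If every block is B-clustered for `drop r`, so is blocks Y ℓ: words from
  -- different blocks differ in their last letter, which `drop r` keeps.
  blocks-clustered : ∀ r B Y ℓ → (∀ a → All (λ u → r ≤ length u) (Y a)) →
                     (∀ a → Clustered (drop r) B (Y a)) → Clustered (drop r) B (blocks Y ℓ)
  blocks-clustered r B Y zero    long cl ()
  blocks-clustered r B Y (suc ℓ) long cl =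
    ++-clustered (map (_∷ʳ ℓ) (Y ℓ)) apart
      (map-clustered (_∷ʳ ℓ) (λ r≤u r≤v same → proj₁ (drop-∷ʳ-injective r≤u r≤v same)) (long ℓ) (cl ℓ))
      (blocks-clustered r B Y ℓ long cl)
    where
    ends-below : All (EndsBelow r ℓ) (blocks Y ℓ)
    ends-below = all-blocks Y ℓ (λ a a<ℓ → All.map (λ {v} r≤v → a , a<ℓ , v , r≤v , refl) (long a))

    apart : ∀ {p q x y} → map (_∷ʳ ℓ) (Y ℓ) [ p ]= x → blocks Y ℓ [ q ]= y → drop r x ≢ drop r y
    apart px qy same with position-map (_∷ʳ ℓ) (Y ℓ) px | position-All ends-below qy
    ... | u , pu , refl | a , a<ℓ , v , r≤v , refl =
      ℕₚ.<⇒≢ a<ℓ (sym (proj₂ (drop-∷ʳ-injective (position-All (long ℓ) pu) r≤v same)))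

  sum-≤ : ∀ {C} (g : ℕ → ℕ) ℓ → (∀ a → a < ℓ → g a ≤ C) → sum (map g (downFrom ℓ)) ≤ ℓ * C
  sum-≤ g zero    _   = z≤n
  sum-≤ g (suc ℓ) g≤C = ℕₚ.+-mono-≤ (g≤C ℓ ℕₚ.≤-refl) (sum-≤ g ℓ (λ a a<ℓ → g≤C a (ℕₚ.m≤n⇒m≤1+n a<ℓ)))

  sum-vanishing : ∀ (g : ℕ → ℕ) k d → (∀ a → k ≤ a → g a ≡ 0) →
                  sum (map g (downFrom (d + k))) ≡ sum (map g (downFrom k))
  sum-vanishing g k zero    _   = refl
  sum-vanishing g k (suc d) g≡0 = cong₂ _+_ (g≡0 (d + k) (ℕₚ.m≤n+m k d)) (sum-vanishing g k d g≡0)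

  sum-bound : ∀ {k C} (g : ℕ → ℕ) ℓ → (∀ a → a < k → g a ≤ C) → (∀ a → k ≤ a → g a ≡ 0) →
              sum (map g (downFrom ℓ)) ≤ k * C
  sum-bound {k} {C} g ℓ g≤C g≡0 with ℕₚ.≤-total ℓ k
  ... | inj₁ ℓ≤k = ℕₚ.≤-trans (sum-≤ g ℓ (λ a a<ℓ → g≤C a (ℕₚ.<-≤-trans a<ℓ ℓ≤k))) (ℕₚ.*-monoˡ-≤ C ℓ≤k)
  ... | inj₂ k≤ℓ = begin
    sum (map g (downFrom ℓ))            ≡⟨ cong (λ m → sum (map g (downFrom m))) (ℕₚ.m∸n+n≡m k≤ℓ) ⟨
    sum (map g (downFrom (ℓ ∸ k + k)))  ≡⟨ sum-vanishing g k (ℓ ∸ k) g≡0 ⟩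
    sum (map g (downFrom k))            ≤⟨ sum-≤ g k g≤C ⟩
    k * C                               ∎
    where open ℕₚ.≤-Reasoning

  Restricted : List ℕ → Set
  Restricted u = ∀ {p x} → u [ p ]= x → x ≤ p

  restricted-∷ʳ⁺ : ∀ {u a} → Restricted u → a ≤ length u → Restricted (u ∷ʳ a)
  restricted-∷ʳ⁺ {u} restricted a≤u q with position-++ u q
  ... | inj₁ qu                = restricted qu
  ... | inj₂ (_ , refl , here) = subst (_ ≤_) (sym (ℕₚ.+-identityʳ (length u))) a≤u

  restricted-∷ʳ⁻ : ∀ u {a} → Restricted (u ∷ʳ a) → Restricted u × a ≤ length u
  restricted-∷ʳ⁻ u restricted = (λ q → restricted (position-++ˡ q)) , restricted (position-∷ʳ u)

  -- At most r! words of length r pass a test q accepting only restricted words: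
  -- the last letter a is at most r, and the rest is again restricted.
  restricted-count : ∀ ℓ r (q : List ℕ → Bool) → (∀ u → T (q u) → Restricted u) →
                     length (filterᵇ q (words ℓ r)) ≤ r !
  restricted-count ℓ zero    q _            = length-filter (T? ∘ q) (words ℓ 0)
  restricted-count ℓ (suc r) q q-restricted = begin
    length (filterᵇ q (words ℓ (suc r)))  ≡⟨ cong length (filter-blocks q (λ _ → words ℓ r) ℓ) ⟩
    length (blocks Y ℓ)                   ≡⟨ length-blocks Y ℓ ⟩
    sum (map (length ∘ Y) (downFrom ℓ))   ≤⟨ sum-bound (length ∘ Y) ℓ small none ⟩
    suc r * r !                           ∎
    where
    open ℕₚ.≤-Reasoning

    Y : ℕ → List (List ℕ)
    Y a = filterᵇ (q ∘ (_∷ʳ a)) (words ℓ r)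

    small : ∀ a → a < suc r → length (Y a) ≤ r !
    small a _ = restricted-count ℓ r (q ∘ (_∷ʳ a))
      (λ u qu → proj₁ (restricted-∷ʳ⁻ u (q-restricted (u ∷ʳ a) qu)))

    none : ∀ a → suc r ≤ a → length (Y a) ≡ 0
    none a r<a = cong length (filter-none (T? ∘ q ∘ (_∷ʳ a)) (All.map rejected (words-length ℓ r)))
      where
      rejected : ∀ {u} → length u ≡ r → ¬ T (q (u ∷ʳ a))
      rejected {u} len qu =
        ℕₚ.<⇒≱ r<a (subst (a ≤_) len (proj₂ (restricted-∷ʳ⁻ u (q-restricted (u ∷ʳ a) qu))))

  count-++ : ∀ x (u t : List ℕ) → count x (u ++ t) ≡ count x u + count x t
  count-++ x []      t = refl
  count-++ x (y ∷ u) t =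
    trans (cong (λ c → (if x ≡ᵇ y then 1 else 0) + c) (count-++ x u t))
          (sym (ℕₚ.+-assoc (if x ≡ᵇ y then 1 else 0) (count x u) (count x t)))

  count-self : ∀ a → count a [ a ] ≡ 1
  count-self a with a ≡ᵇ a | ℕₚ.≡⇒≡ᵇ a a refl
  ... | true  | _ = refl
  ... | false | ()

  count-other : ∀ {x a} → x ≢ a → count x [ a ] ≡ 0
  count-other {x} {a} x≢a with x ≡ᵇ a in eq
  ... | true  = ⊥-elim (x≢a (ℕₚ.≡ᵇ⇒≡ x a (subst T (sym eq) tt)))
  ... | false = refl

  count-position : ∀ i v → 1 ≤ count i v → Σ ℕ λ p → v [ p ]= i
  count-position i (y ∷ v) occurs with i ≡ᵇ y in eq
  ... | true  = 0 , subst (λ z → (y ∷ v) [ 0 ]= z) (sym (ℕₚ.≡ᵇ⇒≡ i y (subst T (sym eq) tt))) here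
  ... | false = let (p , q) = count-position i v occurs in suc p , there q

  occurs-below : ∀ {i v} → Restricted v → 1 ≤ count i v → i < length v
  occurs-below {i} {v} restricted occurs =
    let (p , q) = count-position i v occurs in ℕₚ.≤-<-trans (restricted q) (position-< q)

  -- The ballot condition on u ∷ʳ a with u restricted forces a ≤ length u:
  -- a letter suc i needs an earlier letter i, which sits before position length u.
  ballot-letter : ∀ ℓ u a → Restricted u → a < ℓ →
                  (∀ {i} → i < ℓ → count (suc i) (u ∷ʳ a) ≤ count i (u ∷ʳ a)) → a ≤ length u
  ballot-letter ℓ u zero    _          _   _      = z≤n
  ballot-letter ℓ u (suc i) restricted a<ℓ ballot = occurs-below restricted i-occurs
    where
    open ℕₚ.≤-Reasoning
    i-occurs : 1 ≤ count i u
    i-occurs = begin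
      1                                           ≡⟨ count-self (suc i) ⟨
      count (suc i) [ suc i ]                     ≤⟨ ℕₚ.m≤n+m _ (count (suc i) u) ⟩
      count (suc i) u + count (suc i) [ suc i ]   ≡⟨ count-++ (suc i) u [ suc i ] ⟨
      count (suc i) (u ∷ʳ suc i)                  ≤⟨ ballot (ℕₚ.<-trans (ℕₚ.n<1+n i) a<ℓ) ⟩
      count i (u ∷ʳ suc i)                        ≡⟨ count-++ i u [ suc i ] ⟩
      count i u + count i [ suc i ]               ≡⟨ cong (λ c → count i u + c) (count-other {i} (ℕₚ.1+n≢n ∘ sym)) ⟩
      count i u + 0                               ≡⟨ ℕₚ.+-identityʳ (count i u) ⟩
      count i u                                   ∎

  all⇒All : ∀ {A : Set} (p : A → Bool) xs → T (all p xs) → All (T ∘ p) xs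
  all⇒All p []       _ = []
  all⇒All p (x ∷ xs) h =
    let (px , pxs) = Equivalence.to (T-∧ {p x}) h in px ∷ all⇒All p xs pxs

  all-inits : ∀ {P : List ℕ → Set} u t → All P (inits (u ++ t)) → P u
  all-inits []      t (pu ∷ _) = pu
  all-inits (x ∷ u) t (_ ∷ ps) = all-inits u t (map⁻ ps)

  lattice-prefix : ∀ ℓ u t → T (latticeᵇ ℓ (u ++ t)) →
                   ∀ {i} → i < ℓ → count (suc i) u ≤ count i u
  lattice-prefix ℓ u t lattice {i} i<ℓ =
    ℕₚ.≤ᵇ⇒≤ _ _ (applyUpTo⁻ id ℓ (all⇒All _ (upTo ℓ) (all-inits u t (all⇒All _ (inits (u ++ t)) lattice))) i<ℓ)

  lattice-restricted : ∀ ℓ u t → T (latticeᵇ ℓ (u ++ t)) → All (_< ℓ) u → Restricted u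
  lattice-restricted ℓ u = go (reverseView u)
    where
    go : ∀ {u} → Reverse u → ∀ t → T (latticeᵇ ℓ (u ++ t)) → All (_< ℓ) u → Restricted u
    go []             t _       _       ()
    go (v ∶ rv ∶ʳ a) t lattice letters =
      let (v<ℓ , a<ℓ) = ∷ʳ⁻ letters
          v-restricted = go rv (a ∷ t) (subst (T ∘ latticeᵇ ℓ) (++-assoc v [ a ] t) lattice) v<ℓ
      in restricted-∷ʳ⁺ v-restricted
           (ballot-letter ℓ v a v-restricted a<ℓ (lattice-prefix ℓ (v ∷ʳ a) t lattice))

  syt-prefix-restricted : ∀ λ' u t → T (isSYTᵇ λ' (u ++ t)) → Restricted u
  syt-prefix-restricted λ' u t syt =
    let ℓ = length λ'
        (lattice , shape) = Equivalence.to (T-∧ {latticeᵇ ℓ (u ++ t)}) syt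
        (letters , _) = Equivalence.to (T-∧ {all (λ x → x <ᵇ ℓ) (u ++ t)}) shape
        u<ℓ = proj₁ (++⁻ u (All.map (λ {x} → ℕₚ.<ᵇ⇒< x ℓ) (all⇒All _ (u ++ t) letters)))
    in lattice-restricted ℓ u t lattice u<ℓ

  -- Induction on m: each step appends one letter
  -- via blocks; at m = 0 the whole list has at most r! entries.
  suffix-clustered : ∀ ℓ r m (q : List ℕ → Bool) → (∀ u t → T (q (u ++ t)) → Restricted u) →
                     Clustered (drop r) (r !) (filterᵇ q (words ℓ (m + r)))
  suffix-clustered ℓ r zero    q q-restricted =
    short-clustered (restricted-count ℓ r q
      (λ u qu → q-restricted u [] (subst (T ∘ q) (sym (++-identityʳ u)) qu)))
  suffix-clustered ℓ r (suc m) q q-restricted =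
    subst (Clustered (drop r) (r !)) (sym (filter-blocks q (λ _ → words ℓ (m + r)) ℓ))
      (blocks-clustered r (r !) Y ℓ long block-clustered)
    where
    Y : ℕ → List (List ℕ)
    Y a = filterᵇ (q ∘ (_∷ʳ a)) (words ℓ (m + r))

    long : ∀ a → All (λ u → r ≤ length u) (Y a)
    long a = filter⁺ (T? ∘ q ∘ (_∷ʳ a))
      (All.map (λ len → subst (r ≤_) (sym len) (ℕₚ.m≤n+m r m)) (words-length ℓ (m + r)))

    block-clustered : ∀ a → Clustered (drop r) (r !) (Y a)
    block-clustered a = suffix-clustered ℓ r m (q ∘ (_∷ʳ a))
      (λ u t qu → q-restricted u (t ∷ʳ a) (subst (T ∘ q) (++-assoc u t [ a ]) qu))

  syt-clustered : ∀ λ' n r → r ≤ n → Clustered (drop r) (r !) (SYT λ' n)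
  syt-clustered λ' n r r≤n =
    subst (λ m → Clustered (drop r) (r !) (SYT λ' m)) (ℕₚ.m∸n+n≡m r≤n)
      (suffix-clustered (length λ') r (n ∸ r) (isSYTᵇ λ') (syt-prefix-restricted λ'))

open LastLetterOrder using (lookup-position; syt-clustered)

drop-swapAt : ∀ k r (w : List ℕ) → k < r → drop r (swapAt k w) ≡ drop r w
drop-swapAt zero          r             w           _         = refl
drop-swapAt (suc zero)    r             []          _         = refl
drop-swapAt (suc zero)    r             (x ∷ [])    _         = refl
drop-swapAt (suc zero)    (suc (suc r)) (x ∷ y ∷ w) _         = refl
drop-swapAt (suc zero)    (suc zero)    (x ∷ y ∷ w) (s≤s ())
drop-swapAt (suc (suc k)) r             []          _         = refl
drop-swapAt (suc (suc k)) (suc r)       (x ∷ w)     (s≤s k<r) = drop-swapAt (suc k) r w k<r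

eqListᵇ⇒≡ : ∀ u v → T (eqListᵇ u v) → u ≡ v
eqListᵇ⇒≡ []      []      _  = refl
eqListᵇ⇒≡ (x ∷ u) (y ∷ v) eq =
  let (x≡y , u≡v) = Equivalence.to (T-∧ {x ≡ᵇ y}) eq
  in cong₂ _∷_ (ℕₚ.≡ᵇ⇒≡ x y x≡y) (eqListᵇ⇒≡ u v u≡v)

module BlockDiagonal {c ℓ} (R : CommutativeRing c ℓ) where
  open CommutativeRing R
    using (Carrier; _≈_; _*_; 0#; +-cong; +-identityˡ; zeroˡ; zeroʳ; *-congˡ; *-congʳ)
    renaming (refl to ≈-refl; trans to ≈-trans)
  open Young R

  BlockDiag : ∀ {m} {K : Set} → (Fin m → K) → Matrix m → Set ℓ
  BlockDiag κ M = ∀ i j → κ i ≢ κ j → M i j ≈ 0#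

  ∑-zero : ∀ {m} (f : Fin m → Carrier) → (∀ t → f t ≈ 0#) → ∑ f ≈ 0#
  ∑-zero {zero}  f _   = ≈-refl
  ∑-zero {suc m} f f≈0 =
    ≈-trans (+-cong (f≈0 Fin.zero) (∑-zero (f ∘ Fin.suc) (f≈0 ∘ Fin.suc))) (+-identityˡ 0#)

  idM-blockDiag : ∀ {m} {K : Set} (κ : Fin m → K) → BlockDiag κ idM
  idM-blockDiag κ i j κi≢κj with toℕ i ≡ᵇ toℕ j in eq
  ... | true  = ⊥-elim (κi≢κj (cong κ (Finₚ.toℕ-injective (ℕₚ.≡ᵇ⇒≡ (toℕ i) (toℕ j) (subst T (sym eq) tt)))))
  ... | false = ≈-refl

  -- Every term A i t · B t j of a product entry between different keys has a
  -- factor between different keys.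
  ⊛-blockDiag : ∀ {m} {K : Set} → DecidableEquality K → (κ : Fin m → K) →
                ∀ {A B} → BlockDiag κ A → BlockDiag κ B → BlockDiag κ (A ⊛ B)
  ⊛-blockDiag _≟_ κ {A} {B} A-diag B-diag i j κi≢κj = ∑-zero _ term-zero
    where
    term-zero : ∀ t → A i t * B t j ≈ 0#
    term-zero t with κ i ≟ κ t
    ... | yes κi≡κt = ≈-trans (*-congˡ (B-diag t j (λ κt≡κj → κi≢κj (trans κi≡κt κt≡κj)))) (zeroʳ _)
    ... | no  κi≢κt = ≈-trans (*-congʳ (A-diag i t κi≢κt)) (zeroˡ _)

  module _ (inv sq : ℤ → Carrier) (λ' : List ℕ) (n r : ℕ) where
    open Orth inv sq λ' n

    suffix : Fin (dim λ' n) → List ℕ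
    suffix i = drop r (tab λ' n i)

    if-zero : ∀ b₁ b₂ {x y} → ¬ T b₁ → ¬ T b₂ → (if b₁ then x else (if b₂ then y else 0#)) ≈ 0#
    if-zero true  _     ¬b₁ _   = ⊥-elim (¬b₁ tt)
    if-zero false true  _   ¬b₂ = ⊥-elim (¬b₂ tt)
    if-zero false false _   _   = ≈-refl

    -- π^λ(s_k) for k < r only connects T with T and with T with k, k+1 exchanged.
    πs-blockDiag : ∀ k → k < r → BlockDiag suffix (πs k)
    πs-blockDiag k k<r i j suffixes≢ =
      if-zero (eqListᵇ S T′) (eqListᵇ S (swapAt k T′))
        (λ S≡T → suffixes≢ (sym (cong (drop r) (eqListᵇ⇒≡ S T′ S≡T))))
        (λ S≡sT → suffixes≢ (sym (trans (cong (drop r) (eqListᵇ⇒≡ S (swapAt k T′) S≡sT))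
                                        (drop-swapAt k r T′ k<r))))
      where
      T′ S : List ℕ
      T′ = tab λ' n i
      S  = tab λ' n j

    πword-blockDiag : ∀ w → All (_< r) w → BlockDiag suffix (πword w)
    πword-blockDiag []      _            = idM-blockDiag suffix
    πword-blockDiag (k ∷ w) (k<r ∷ w<r) =
      ⊛-blockDiag (≡-dec ℕₚ._≟_) suffix (πs-blockDiag k k<r) (πword-blockDiag w w<r)

mainTheorem9 :
    ∀ {c ℓ} (R : CommutativeRing c ℓ) →
    let open CommutativeRing R
        open Young R
    in (inv sq : ℤ → Carrier) →
       (∀ a → ¬ (a ≡ + 0) → intR a * inv a ≈ 1#) →
       (∀ a → sq a * sq a ≈ 1# - inv a * inv a) →
       (r n : ℕ) → r < n →
       (λ' : List ℕ) → IsPartitionOf λ' n →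
       (σ : Permutation′ r) →
       (w : List ℕ) → All (λ k → 1 ≤ k × k < r) w →
       (∀ (x : Fin r) → wordPerm w (suc (toℕ x)) ≡ suc (toℕ (σ ⟨$⟩ʳ x))) →
       ∀ (i j : Fin (dim λ' n)) → r ! < ∣ toℕ i - toℕ j ∣ →
       Orth.πword inv sq λ' n w i j ≈ 0#
mainTheorem9 R inv sq _ _ r n r<n λ' _ _ w w-letters _ i j far =
  πword-blockDiag inv sq λ' n r w (All.map proj₂ w-letters) i j suffixes-differ
  where
  open BlockDiagonal R
  -- Equal suffixes would put i and j fewer than r! apart.
  suffixes-differ : drop r (tab λ' n i) ≢ drop r (tab λ' n j)
  suffixes-differ same =
    ℕₚ.<-asym far (syt-clustered λ' n r (ℕₚ.<⇒≤ r<n)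
      (lookup-position (SYT λ' n) i) (lookup-position (SYT λ' n) j) same)
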